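{- Let $(X,Y)$ be a minimal divider of a matroid $N$. Then ${\rm cl}(X)\cap{\rm cl}(Y)={\rm cl}(X)\cap{\rm cl}(Y-{\rm cl}(X))$.
   Context: A partition $(X,Y)$ of $E(N)$ is a vertical $k$-separation if $r(X)+r(Y)-r(N)\le k-1$ and $\min\{r(X),r(Y)\}\ge k$; it is exact if $r(X)+r(Y)-r(N)=k-1$. A divider is an exact vertical $k$-separation for some $k$. A divider $(X,Y)$ is minimal if there is no vertical $k'$-separation $(X',Y')$ (for any $k'$) with ${\rm cl}(X')\cap{\rm cl}(Y')\subsetneqq{\rm cl}(X)\cap{\rm cl}(Y)$. -}

module Defs where

open import Data.Nat using (ℕ; suc; _+_; _≤_; _<_)
open import Data.Nat.Properties using (_≟_)
open import Data.Fin using (Fin)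
open import Data.Fin.Subset using (Subset; _∈_; _∉_; _⊆_; _⊂_; _∪_; _∩_; ⁅_⁆; ⊤; ⊥; ∣_∣)
open import Data.Vec using (tabulate)
open import Data.Bool using (Bool)
open import Data.Product using (Σ; ∃; _×_)
open import Data.Sum using (_⊎_)
open import Relation.Nullary using (¬_)
open import Relation.Nullary.Decidable using (⌊_⌋)
open import Relation.Binary.PropositionalEquality using (_≡_)

record Matroid (n : ℕ) : Set where
  field
    r        : Subset n → ℕ
    r-bound  : ∀ X → r X ≤ ∣ X ∣
    r-mono   : ∀ {X Y} → X ⊆ Y → r X ≤ r Y
    r-submod : ∀ X Y → r (X ∪ Y) + r (X ∩ Y) ≤ r X + r Y

module _ {n : ℕ} (N : Matroid n) where
  open Matroid N

  cl : Subset n → Subset n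
  cl X = tabulate (λ e → ⌊ r (X ∪ ⁅ e ⁆) ≟ r X ⌋)

  IsPartition : Subset n → Subset n → Set
  IsPartition X Y = (∀ e → e ∈ X ⊎ e ∈ Y) × (∀ e → e ∈ X → e ∉ Y)

  -- vertical k-separation:  r X + r Y - r N ≤ k - 1  and  min(r X, r Y) ≥ k
  -- (stated in ℕ as  r X + r Y < r E + k, equivalent to the integer inequality)
  IsVerticalSep : ℕ → Subset n → Subset n → Set
  IsVerticalSep k X Y =
    IsPartition X Y × (r X + r Y < r ⊤ + k) × (k ≤ r X) × (k ≤ r Y)

  IsExactVerticalSep : ℕ → Subset n → Subset n → Set
  IsExactVerticalSep k X Y =
    IsVerticalSep k X Y × (suc (r X + r Y) ≡ r ⊤ + k)

  IsDivider : Subset n → Subset n → Set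
  IsDivider X Y = ∃ λ k → IsExactVerticalSep k X Y

  IsMinimalDivider : Subset n → Subset n → Set
  IsMinimalDivider X Y =
    IsDivider X Y ×
    (∀ k' X' Y' → IsVerticalSep k' X' Y' → ¬ ((cl X' ∩ cl Y') ⊂ (cl X ∩ cl Y)))

{-# OPTIONS --safe #-}
-- Replace (X , Y) by (X′ , Y′) with Y′ = Y − cl X and X′ its complement. Then
-- X ⊆ X′ ⊆ cl X, so X′ has the rank and the closure of X, and Y′ ⊆ Y; hence both
-- sides are still non-spanning, (X′ , Y′) is a vertical separation, and its guts
-- cl X ∩ cl Y′ lie inside cl X ∩ cl Y. Minimality of (X , Y) forbids the
-- inclusion to be proper.
module Submission where

open import Defs
open import Data.Bool.Properties using (T-≡)
open import Data.Fin using (Fin)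
open import Data.Fin.Properties using (any?; _≟_)
open import Data.Fin.Subset
open import Data.Fin.Subset.Induction using (⊂-wellFounded)
open import Data.Fin.Subset.Properties
  using (_∈?_; ⊆-refl; ⊆-trans; ⊆-antisym; p⊆p∪q; x∈p∪q⁻; x∈p∪q⁺; x∈p∩q⁺; x∈p∩q⁻;
         x∈⁅x⁆; x∈⁅y⁆⇒x≡y; x∈p∧x≢y⇒x∈p-y; x∈p⇒p-x⊂p; p─q⊆p; x∈p∧x∉q⇒x∈p─q; x∈∁p⇒x∉p; x∉p⇒x∈∁p)
open import Data.Nat using (ℕ; suc; _+_; _∸_; _≤_; _<_)
open import Data.Nat.Properties
  using (≤-trans; ≤-reflexive; ≤-antisym; ≤-<-trans; <-≤-trans; +-comm; +-suc; +-mono-≤; +-monoˡ-≤;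
         +-monoʳ-≤; +-cancelʳ-≤; +-cancelʳ-<; +-cancelˡ-<; m≤n+m∸n; m≤n+o⇒m∸n≤o; module ≤-Reasoning)
open import Data.Product using (_,_; proj₁)
open import Data.Sum using (_⊎_; inj₁; inj₂)
open import Data.Vec using (_∷_; there)
open import Data.Vec.Properties using (lookup∘tabulate; []=⇒lookup; lookup⇒[]=)
open import Function.Bundles using (Equivalence)
open import Induction.WellFounded using (Acc; acc)
open import Relation.Nullary using (¬_; yes; no; contradiction)
open import Relation.Nullary.Decidable using (fromWitness; toWitness)
open import Relation.Binary.PropositionalEquality using (_≡_; refl; sym; trans)

private
  variable
    n : ℕ
    p q p′ q′ : Subset n

x∈p─q⇒x∉q : ∀ {x : Fin n} (p q : Subset n) → x ∈ p ─ q → x ∉ q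
x∈p─q⇒x∉q (_ ∷ p) (outside ∷ q) (there x∈p─q) (there x∈q) = x∈p─q⇒x∉q p q x∈p─q x∈q
x∈p─q⇒x∉q (_ ∷ p) (inside  ∷ q) (there x∈p─q) (there x∈q) = x∈p─q⇒x∉q p q x∈p─q x∈q

∩-mono-⊆ : p ⊆ p′ → q ⊆ q′ → p ∩ q ⊆ p′ ∩ q′
∩-mono-⊆ {p = p} {q = q} p⊆p′ q⊆q′ x∈p∩q =
  let x∈p , x∈q = x∈p∩q⁻ p q x∈p∩q in x∈p∩q⁺ (p⊆p′ x∈p , q⊆q′ x∈q)

∪-monoˡ-⊆ : p ⊆ p′ → p ∪ q ⊆ p′ ∪ q
∪-monoˡ-⊆ {p = p} {q = q} p⊆p′ x∈p∪q with x∈p∪q⁻ p q x∈p∪q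
... | inj₁ x∈p = x∈p∪q⁺ (inj₁ (p⊆p′ x∈p))
... | inj₂ x∈q = x∈p∪q⁺ (inj₂ x∈q)

p⊆p-x∪⁅x⁆ : ∀ (x : Fin n) → p ⊆ (p - x) ∪ ⁅ x ⁆
p⊆p-x∪⁅x⁆ x {y} y∈p with y ≟ x
... | yes refl = x∈p∪q⁺ (inj₂ (x∈⁅x⁆ x))
... | no y≢x   = x∈p∪q⁺ (inj₁ (x∈p∧x≢y⇒x∈p-y y∈p y≢x))

⊆∧⊄⇒⊇ : p ⊆ q → ¬ (p ⊂ q) → q ⊆ p
⊆∧⊄⇒⊇ {p = p} p⊆q p⊄q {x} x∈q with x ∈? p
... | yes x∈p = x∈p
... | no  x∉p = contradiction ((λ {y} → p⊆q {y}) , x , x∈q , x∉p) p⊄q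

module _ (N : Matroid n) where
  open Matroid N

  ∈-cl⁺ : ∀ {X e} → r (X ∪ ⁅ e ⁆) ≤ r X → e ∈ cl N X
  ∈-cl⁺ {X} {e} r[X∪e]≤rX = lookup⇒[]= e (cl N X)
    (trans (lookup∘tabulate _ e)
           (Equivalence.to T-≡ (fromWitness (≤-antisym r[X∪e]≤rX (r-mono (p⊆p∪q ⁅ e ⁆))))))

  ∈-cl⁻ : ∀ {X e} → e ∈ cl N X → r (X ∪ ⁅ e ⁆) ≤ r X
  ∈-cl⁻ {X} {e} e∈clX = ≤-reflexive (toWitness (Equivalence.from T-≡
    (trans (sym (lookup∘tabulate _ e)) ([]=⇒lookup e∈clX))))

  ⊆-cl : ∀ {X} → X ⊆ cl N X
  ⊆-cl {X} {e} e∈X = ∈-cl⁺ (r-mono X∪e⊆X)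
    where
    X∪e⊆X : X ∪ ⁅ e ⁆ ⊆ X
    X∪e⊆X x∈X∪e with x∈p∪q⁻ X ⁅ e ⁆ x∈X∪e
    ... | inj₁ x∈X = x∈X
    ... | inj₂ x∈e rewrite x∈⁅y⁆⇒x≡y e x∈e = e∈X

  -- Submodularity applied to X ∪ {e} and Z, whose intersection contains X.
  r-∪-⁅⁆-≤ : ∀ {X Z e} → X ⊆ Z → e ∈ cl N X → r (Z ∪ ⁅ e ⁆) ≤ r Z
  r-∪-⁅⁆-≤ {X} {Z} {e} X⊆Z e∈clX = +-cancelʳ-≤ (r X) _ _ (begin
    r (Z ∪ ⁅ e ⁆) + r X                         ≤⟨ +-mono-≤ (r-mono Z∪e⊆X∪e∪Z) (r-mono X⊆X∪e∩Z) ⟩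
    r ((X ∪ ⁅ e ⁆) ∪ Z) + r ((X ∪ ⁅ e ⁆) ∩ Z)  ≤⟨ r-submod (X ∪ ⁅ e ⁆) Z ⟩
    r (X ∪ ⁅ e ⁆) + r Z                         ≤⟨ +-monoˡ-≤ (r Z) (∈-cl⁻ e∈clX) ⟩
    r X + r Z                                   ≡⟨ +-comm (r X) (r Z) ⟩
    r Z + r X                                   ∎)
    where
    open ≤-Reasoning
    Z∪e⊆X∪e∪Z : Z ∪ ⁅ e ⁆ ⊆ (X ∪ ⁅ e ⁆) ∪ Z
    Z∪e⊆X∪e∪Z x∈Z∪e with x∈p∪q⁻ Z ⁅ e ⁆ x∈Z∪e
    ... | inj₁ x∈Z = x∈p∪q⁺ (inj₂ x∈Z)
    ... | inj₂ x∈e = x∈p∪q⁺ (inj₁ (x∈p∪q⁺ (inj₂ x∈e)))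
    X⊆X∪e∩Z : X ⊆ (X ∪ ⁅ e ⁆) ∩ Z
    X⊆X∪e∩Z x∈X = x∈p∩q⁺ (p⊆p∪q ⁅ e ⁆ x∈X , X⊆Z x∈X)

  cl-mono : ∀ {X Z} → X ⊆ Z → cl N X ⊆ cl N Z
  cl-mono X⊆Z e∈clX = ∈-cl⁺ (r-∪-⁅⁆-≤ X⊆Z e∈clX)

  -- Well-founded induction on Z: remove one element of Z − X and add it back.
  r-≤-between : ∀ {X Z} → X ⊆ Z → Z ⊆ cl N X → r Z ≤ r X
  r-≤-between {X} {Z} = go Z (⊂-wellFounded Z)
    where
    go : ∀ Z → Acc _⊂_ Z → X ⊆ Z → Z ⊆ cl N X → r Z ≤ r X
    go Z (acc rec) X⊆Z Z⊆clX with any? (λ e → e ∈? (Z ─ X))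
    ... | no ∄e = r-mono Z⊆X
      where
      Z⊆X : Z ⊆ X
      Z⊆X {e} e∈Z with e ∈? X
      ... | yes e∈X = e∈X
      ... | no  e∉X = contradiction (e , x∈p∧x∉q⇒x∈p─q e∈Z e∉X) ∄e
    ... | yes (e , e∈Z─X) = begin
      r Z                     ≤⟨ r-mono (p⊆p-x∪⁅x⁆ e) ⟩
      r ((Z - e) ∪ ⁅ e ⁆)     ≤⟨ r-∪-⁅⁆-≤ X⊆Z-e (Z⊆clX e∈Z) ⟩
      r (Z - e)               ≤⟨ go (Z - e) (rec (x∈p⇒p-x⊂p e∈Z)) X⊆Z-e (⊆-trans (p─q⊆p Z ⁅ e ⁆) Z⊆clX) ⟩
      r X                     ∎
      where
      open ≤-Reasoning
      e∈Z : e ∈ Z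
      e∈Z = p─q⊆p Z X e∈Z─X
      X⊆Z-e : X ⊆ Z - e
      X⊆Z-e x∈X = x∈p∧x≢y⇒x∈p-y (X⊆Z x∈X) λ { refl → x∈p─q⇒x∉q Z X e∈Z─X x∈X }

  cl-⊆-between : ∀ {X Z} → X ⊆ Z → Z ⊆ cl N X → cl N Z ⊆ cl N X
  cl-⊆-between {X} {Z} X⊆Z Z⊆clX {e} e∈clZ = ∈-cl⁺ (begin
    r (X ∪ ⁅ e ⁆)  ≤⟨ r-mono (∪-monoˡ-⊆ X⊆Z) ⟩
    r (Z ∪ ⁅ e ⁆)  ≤⟨ ∈-cl⁻ e∈clZ ⟩
    r Z            ≤⟨ r-≤-between X⊆Z Z⊆clX ⟩
    r X            ∎)
    where open ≤-Reasoning

  ∁-IsPartition : ∀ Y → IsPartition N (∁ Y) Y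
  ∁-IsPartition Y = cover , λ _ e∈∁Y → x∈∁p⇒x∉p e∈∁Y
    where
    cover : ∀ e → e ∈ ∁ Y ⊎ e ∈ Y
    cover e with e ∈? Y
    ... | yes e∈Y = inj₂ e∈Y
    ... | no  e∉Y = inj₁ (x∉p⇒x∈∁p e∉Y)

  IsPartition⇒⊆∁─ : ∀ {X Y} Z → IsPartition N X Y → X ⊆ ∁ (Y ─ Z)
  IsPartition⇒⊆∁─ {Y = Y} Z (_ , disjoint) x∈X =
    x∉p⇒x∈∁p λ x∈Y─Z → disjoint _ x∈X (p─q⊆p Y Z x∈Y─Z)

  IsPartition⇒∁─⊆ : ∀ {X Y Z} → IsPartition N X Y → X ⊆ Z → ∁ (Y ─ Z) ⊆ Z
  IsPartition⇒∁─⊆ {Z = Z} (cover , _) X⊆Z {e} e∈∁[Y─Z] with cover e | e ∈? Z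
  ... | _        | yes e∈Z = e∈Z
  ... | inj₁ e∈X | no  _   = X⊆Z e∈X
  ... | inj₂ e∈Y | no  e∉Z = contradiction (x∈p∧x∉q⇒x∈p─q e∈Y e∉Z) (x∈∁p⇒x∉p e∈∁[Y─Z])

  IsVerticalSep⇒r<r⊤ˡ : ∀ {k X Y} → IsVerticalSep N k X Y → r X < r ⊤
  IsVerticalSep⇒r<r⊤ˡ {X = X} {Y} (_ , order , _ , k≤rY) =
    +-cancelʳ-< (r Y) (r X) (r ⊤) (<-≤-trans order (+-monoʳ-≤ (r ⊤) k≤rY))

  IsVerticalSep⇒r<r⊤ʳ : ∀ {k X Y} → IsVerticalSep N k X Y → r Y < r ⊤
  IsVerticalSep⇒r<r⊤ʳ {X = X} {Y} (_ , order , k≤rX , _) =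
    +-cancelˡ-< (r X) (r Y) (r ⊤)
      (<-≤-trans order (≤-trans (+-monoʳ-≤ (r ⊤) k≤rX) (≤-reflexive (+-comm (r ⊤) (r X)))))

  -- The order k = r X + r Y − r E + 1 is the least one the rank condition allows.
  non-spanning⇒IsVerticalSep : ∀ {X Y} → IsPartition N X Y → r X < r ⊤ → r Y < r ⊤ →
                               IsVerticalSep N (suc (r X + r Y) ∸ r ⊤) X Y
  non-spanning⇒IsVerticalSep {X} {Y} partition rX<r⊤ rY<r⊤ =
    partition , m≤n+m∸n (suc (r X + r Y)) (r ⊤) , order-≤ (r X) (r Y) rY<r⊤ , k≤rY
    where
    order-≤ : ∀ a b → b < r ⊤ → suc (a + b) ∸ r ⊤ ≤ a
    order-≤ a b b<r⊤ = m≤n+o⇒m∸n≤o (suc (a + b)) (r ⊤)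
      (≤-trans (≤-reflexive (sym (+-suc a b))) (≤-trans (+-monoʳ-≤ a b<r⊤) (≤-reflexive (+-comm a (r ⊤)))))
    k≤rY : suc (r X + r Y) ∸ r ⊤ ≤ r Y
    k≤rY rewrite +-comm (r X) (r Y) = order-≤ (r Y) (r X) rX<r⊤

lemma4p2 : {n : ℕ} (N : Matroid n) (X Y : Subset n) → IsMinimalDivider N X Y →
    (cl N X ∩ cl N Y) ≡ (cl N X ∩ cl N (Y ─ cl N X))
lemma4p2 N X Y ((_ , sep , _) , minimal) =
  ⊆-antisym (⊆-trans guts⊆guts′ (∩-mono-⊆ clX′⊆clX ⊆-refl)) (∩-mono-⊆ ⊆-refl (cl-mono N Y′⊆Y))
  where
  open Matroid N
  Y′ = Y ─ cl N X
  X′ = ∁ Y′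
  Y′⊆Y : Y′ ⊆ Y
  Y′⊆Y = p─q⊆p Y (cl N X)
  X⊆X′ : X ⊆ X′
  X⊆X′ = IsPartition⇒⊆∁─ N (cl N X) (proj₁ sep)
  X′⊆clX : X′ ⊆ cl N X
  X′⊆clX = IsPartition⇒∁─⊆ N (proj₁ sep) (⊆-cl N)
  clX′⊆clX : cl N X′ ⊆ cl N X
  clX′⊆clX = cl-⊆-between N X⊆X′ X′⊆clX
  sep′ : IsVerticalSep N (suc (r X′ + r Y′) ∸ r ⊤) X′ Y′
  sep′ = non-spanning⇒IsVerticalSep N (∁-IsPartition N Y′)
    (≤-<-trans (r-≤-between N X⊆X′ X′⊆clX) (IsVerticalSep⇒r<r⊤ˡ N sep))
    (≤-<-trans (r-mono Y′⊆Y) (IsVerticalSep⇒r<r⊤ʳ N sep))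
  guts⊆guts′ : cl N X ∩ cl N Y ⊆ cl N X′ ∩ cl N Y′
  guts⊆guts′ = ⊆∧⊄⇒⊇ (∩-mono-⊆ clX′⊆clX (cl-mono N Y′⊆Y)) (minimal _ X′ Y′ sep′)
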